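{- Let $G=(V,A)$ be a finite directed graph and $c: V\to\mathbb{N}$ a capacity function. Run the following local search algorithm. Start with $M=\emptyset$. Repeat the following pass until a pass makes no change: for each vertex $v\in V\setminus D^M$, set $D=D^M\cup\{v\}$ and $P=V\setminus D$, compute a maximum-cardinality fixed carpool matching $M'$ for the partition $(P,D)$, and if $|M'|>|M|$ replace $M$ by $M'$. Here $D^M=\{u\in V : \text{the in-degree of } u \text{ in } (V,M) \text{ is positive}\}$, and a fixed carpool matching for $(P,D)$ is a set $M'\subseteq A\cap(P\times D)$ such that every $d\in D$ has in-degree at most $c(d)$ in $(V,M')$ and every $p\in P$ has out-degree at most $1$ in $(V,M')$. Then the algorithm is a $2$-approximation algorithm for the Unweighted Carpool Matching problem: the returned set $M$ is a feasible carpool matching and $|M^*|\le 2|M|$ for every feasible carpool matching $(P^*,D^*,M^*)$ of $(G,c)$.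
   Context: A feasible carpool matching of $(G,c)$ is a triple $(P,D,M)$ where $P$ and $D$ partition $V$, $M\subseteq A\cap(P\times D)$, every $d\in D$ has in-degree at most $c(d)$ in $(V,M)$, and every $p\in P$ has out-degree at most $1$ in $(V,M)$. The Unweighted Carpool Matching problem asks for a feasible carpool matching maximizing $|M|$. A maximum-cardinality fixed carpool matching for a given partition $(P,D)$ can be computed in polynomial time (via an integral maximum flow). -}

module Defs where

open import Data.Nat using (ℕ; zero; suc; _+_; _*_; _≤_; _<_)
open import Data.Fin using (Fin; zero; suc; _≟_)
open import Relation.Nullary.Decidable using (isYes)
open import Data.Bool using (Bool; true; false; _∨_; if_then_else_)
open import Data.List using (List; []; _∷_; allFin)
open import Data.Product using (_×_; Σ; _,_)
open import Relation.Nullary using (¬_)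
open import Relation.Binary.PropositionalEquality using (_≡_)

-- A finite directed graph on vertex set V = Fin n is given by its arc
-- relation  A : Fin n → Fin n → Bool  (A u v ≡ true iff (u,v) ∈ A).
Digraph : ℕ → Set
Digraph n = Fin n → Fin n → Bool

ArcSet : ℕ → Set
ArcSet n = Fin n → Fin n → Bool

-- A vertex subset (used for D; P is its complement).
VSet : ℕ → Set
VSet n = Fin n → Bool

count : ∀ {n} → (Fin n → Bool) → ℕ
count {zero}  f = 0
count {suc n} f = (if f zero then 1 else 0) + count (λ i → f (suc i))

inDeg : ∀ {n} → ArcSet n → Fin n → ℕ
inDeg M v = count (λ u → M u v)

outDeg : ∀ {n} → ArcSet n → Fin n → ℕ
outDeg M u = count (λ v → M u v)

sumF : ∀ {n} → (Fin n → ℕ) → ℕ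
sumF {zero}  f = 0
sumF {suc n} f = f zero + sumF (λ i → f (suc i))

size : ∀ {n} → ArcSet n → ℕ
size M = sumF (outDeg M)

-- fixed carpool matching for the partition (P, D) with P = V \ D
-- (D d ≡ true  means d ∈ D;  D p ≡ false means p ∈ P)
record FixedMatching {n} (A : Digraph n) (c : Fin n → ℕ) (D : VSet n) (M : ArcSet n) : Set where
  field
    arcs   : ∀ u v → M u v ≡ true → (A u v ≡ true) × (D u ≡ false) × (D v ≡ true)
    capD   : ∀ d → D d ≡ true → inDeg M d ≤ c d
    capP   : ∀ p → D p ≡ false → outDeg M p ≤ 1

Feasible : ∀ {n} → Digraph n → (Fin n → ℕ) → ArcSet n → Set
Feasible A c M = Σ (VSet _) λ D → FixedMatching A c D M

MaxFixed : ∀ {n} → Digraph n → (Fin n → ℕ) → VSet n → ArcSet n → Set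
MaxFixed A c D M = FixedMatching A c D M × (∀ M' → FixedMatching A c D M' → size M' ≤ size M)

emptyArcs : ∀ {n} → ArcSet n
emptyArcs u v = false

isPos : ℕ → Bool
isPos zero    = false
isPos (suc _) = true

DM : ∀ {n} → ArcSet n → VSet n
DM M u = isPos (inDeg M u)

addV : ∀ {n} → VSet n → Fin n → VSet n
addV D v u = D u ∨ isYes (u ≟ v)

data Step {n} (A : Digraph n) (c : Fin n → ℕ) (v : Fin n) : ArcSet n → ArcSet n → Set where
  skip    : ∀ {M} → DM M v ≡ true → Step A c v M M
  improve : ∀ {M M'} → DM M v ≡ false → MaxFixed A c (addV (DM M) v) M' →
            size M < size M' → Step A c v M M'
  keep    : ∀ {M M'} → DM M v ≡ false → MaxFixed A c (addV (DM M) v) M' →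
            size M' ≤ size M → Step A c v M M

data Steps {n} (A : Digraph n) (c : Fin n → ℕ) : List (Fin n) → ArcSet n → ArcSet n → Set where
  done : ∀ {M} → Steps A c [] M M
  next : ∀ {v vs M M' M''} → Step A c v M M' → Steps A c vs M' M'' → Steps A c (v ∷ vs) M M''

Pass : ∀ {n} → Digraph n → (Fin n → ℕ) → ArcSet n → ArcSet n → Set
Pass {n} A c = Steps A c (allFin n)

SameArcs : ∀ {n} → ArcSet n → ArcSet n → Set
SameArcs M M' = ∀ u v → M u v ≡ M' u v

-- Run A c M Mout : starting from current set M, the algorithm (for some
-- choice of the maximum matchings computed) returns Mout.
data Run {n} (A : Digraph n) (c : Fin n → ℕ) : ArcSet n → ArcSet n → Set where
  stop  : ∀ {M M'} → Pass A c M M' → SameArcs M M' → Run A c M M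
  again : ∀ {M M' Mout} → Pass A c M M' → ¬ SameArcs M M' → Run A c M' Mout → Run A c M Mout

-- The run ends at a feasible matching M that is locally optimal: for no vertex v outside D^M does a
-- fixed matching for D^M ∪ {v} have more arcs than M.  Call a vertex covered if it meets an arc of M.
-- Split any fixed matching M* into the arcs leaving covered vertices, charged to their tail, and the
-- arcs leaving uncovered vertices, charged to their head.  A covered vertex outside D* is charged at
-- most one arc.  A vertex x ∈ D* is charged at most in_M x arcs if x ∈ D^M, since otherwise two of
-- its uncovered M*-passengers give a better fixed matching: one joins x, the other becomes the new
-- driver; and at most out_M x arcs if x ∉ D^M, since x may become the driver of its uncovered
-- M*-passengers at the price of its own out-arcs.  So x is charged at most in_M x + out_M x, and
-- summing over x gives |M*| ≤ 2|M|.
module Submission where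

open import Defs
open import Data.Bool using (Bool; true; false; _∨_; _∧_; not; if_then_else_)
open import Data.Bool.Properties using (∧-zeroʳ; ∧-identityʳ; ∨-zeroʳ)
open import Data.Empty using (⊥; ⊥-elim)
open import Data.Fin using (Fin; zero; suc; _≟_)
open import Data.Fin.Properties using (suc-injective)
open import Data.List.Membership.Propositional.Properties using (∈-allFin)
open import Data.List.Relation.Unary.All using (All; []; _∷_) renaming (lookup to All-lookup)
open import Data.Nat using (ℕ; zero; suc; _+_; _*_; _≤_; _<_; z≤n; s≤s)
open import Data.Nat.Properties hiding (_≟_; suc-injective)
open import Algebra.Properties.CommutativeSemigroup +-commutativeSemigroup using (interchange)
open import Data.Product using (_×_; _,_; proj₁; proj₂; ∃; ∃₂)
open import Data.Sum using (_⊎_; inj₁; inj₂)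
open import Function using (_∘_; id)
open import Relation.Binary.PropositionalEquality
open import Relation.Nullary using (¬_; Dec; yes; no)
open import Relation.Nullary.Decidable using (isYes; isYes≗does; dec-true; dec-false)
open ≤-Reasoning

private
  variable
    n : ℕ
    A : Digraph n
    c : Fin n → ℕ
    D S : VSet n
    M N M′ : ArcSet n
    d p q u v w x : Fin n
    a b : Bool
    k : ℕ

isYes⇒ : {P : Set} (P? : Dec P) → isYes P? ≡ true → P
isYes⇒ (yes p) _ = p
isYes⇒ (no _) ()

isYes-yes : {P : Set} (P? : Dec P) → P → isYes P? ≡ true
isYes-yes P? p = trans (isYes≗does P?) (dec-true P? p)

isYes-no : {P : Set} (P? : Dec P) → ¬ P → isYes P? ≡ false
isYes-no P? ¬p = trans (isYes≗does P?) (dec-false P? ¬p)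

≡true⇒≢false : a ≡ true → a ≢ false
≡true⇒≢false refl ()

≢true⇒≡false : a ≢ true → a ≡ false
≢true⇒≡false {false} _ = refl
≢true⇒≡false {true} a≢true = ⊥-elim (a≢true refl)

not≡true⇒≡false : not a ≡ true → a ≡ false
not≡true⇒≡false {false} _ = refl

∧≡true : a ∧ b ≡ true → a ≡ true × b ≡ true
∧≡true {true} b≡true = refl , b≡true

∨≡true : a ∨ b ≡ true → a ≡ true ⊎ b ≡ true
∨≡true {true} _ = inj₁ refl
∨≡true {false} b≡true = inj₂ b≡true

isPos⇒1≤ : isPos k ≡ true → 1 ≤ k
isPos⇒1≤ {suc _} _ = s≤s z≤n

1≤⇒isPos : 1 ≤ k → isPos k ≡ true
1≤⇒isPos (s≤s _) = refl

isPos≡false⇒≡0 : isPos k ≡ false → k ≡ 0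
isPos≡false⇒≡0 {zero} _ = refl

addV-self : (D : VSet n) (v : Fin n) → addV D v v ≡ true
addV-self D v = trans (cong (D v ∨_) (isYes-yes (v ≟ v) refl)) (∨-zeroʳ (D v))

addV-⊇ : D u ≡ true → addV D v u ≡ true
addV-⊇ u∈D rewrite u∈D = refl

addV-∉ : D u ≡ false → u ≢ v → addV D v u ≡ false
addV-∉ {u = u} {v = v} u∉D u≢v rewrite u∉D = isYes-no (u ≟ v) u≢v

-- Finite sums and counts

bit : Bool → ℕ
bit b = if b then 1 else 0

sumF-cong : {f g : Fin n → ℕ} → (∀ i → f i ≡ g i) → sumF f ≡ sumF g
sumF-cong {zero} _ = refl
sumF-cong {suc n} f≗g = cong₂ _+_ (f≗g zero) (sumF-cong (f≗g ∘ suc))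

sumF-mono : {f g : Fin n → ℕ} → (∀ i → f i ≤ g i) → sumF f ≤ sumF g
sumF-mono {zero} _ = z≤n
sumF-mono {suc n} f≤g = +-mono-≤ (f≤g zero) (sumF-mono (f≤g ∘ suc))

sumF-+ : (f g : Fin n → ℕ) → sumF (λ i → f i + g i) ≡ sumF f + sumF g
sumF-+ {zero} f g = refl
sumF-+ {suc n} f g =
  trans (cong (f zero + g zero +_) (sumF-+ (f ∘ suc) (g ∘ suc))) (interchange (f zero) (g zero) _ _)

sumF-zero : {f : Fin n → ℕ} → (∀ i → f i ≡ 0) → sumF f ≡ 0
sumF-zero {zero} _ = refl
sumF-zero {suc n} f≗0 = cong₂ _+_ (f≗0 zero) (sumF-zero (f≗0 ∘ suc))

sumF-single : {f : Fin n → ℕ} (x : Fin n) → (∀ i → i ≢ x → f i ≡ 0) → sumF f ≡ f x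
sumF-single {suc n} {f} zero f≗0 =
  trans (cong (f zero +_) (sumF-zero (λ i → f≗0 (suc i) λ ()))) (+-identityʳ (f zero))
sumF-single {suc n} (suc x) f≗0 =
  cong₂ _+_ (f≗0 zero λ ()) (sumF-single x (λ i i≢x → f≗0 (suc i) (i≢x ∘ suc-injective)))

sumF-point : {f : Fin n → ℕ} (x : Fin n) → f x ≤ sumF f
sumF-point {f = f} zero = m≤m+n (f zero) _
sumF-point {f = f} (suc x) = ≤-trans (sumF-point x) (m≤n+m _ (f zero))

sumF-swap : ∀ {m} (f : Fin n → Fin m → ℕ) →
  sumF (λ i → sumF (λ j → f i j)) ≡ sumF (λ j → sumF (λ i → f i j))
sumF-swap {zero} f = sym (sumF-zero {f = λ j → sumF (λ i → f i j)} (λ _ → refl))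
sumF-swap {suc n} f =
  trans (cong (sumF (f zero) +_) (sumF-swap (f ∘ suc)))
        (sym (sumF-+ (f zero) (λ j → sumF (λ i → f (suc i) j))))

count≡sumF : (f : Fin n → Bool) → count f ≡ sumF (λ i → bit (f i))
count≡sumF {zero} f = refl
count≡sumF {suc n} f = cong (bit (f zero) +_) (count≡sumF (f ∘ suc))

count-cong : {f g : Fin n → Bool} → (∀ i → f i ≡ g i) → count f ≡ count g
count-cong {zero} _ = refl
count-cong {suc n} f≗g = cong₂ _+_ (cong bit (f≗g zero)) (count-cong (f≗g ∘ suc))

count-zero : {f : Fin n → Bool} → (∀ i → f i ≡ false) → count f ≡ 0
count-zero {zero} _ = refl
count-zero {suc n} f≗false rewrite f≗false zero = count-zero (f≗false ∘ suc)

bit-mono : (a ≡ true → b ≡ true) → bit a ≤ bit b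
bit-mono {false} _ = z≤n
bit-mono {true} a⇒b rewrite a⇒b refl = ≤-refl

count-mono : {f g : Fin n → Bool} → (∀ i → f i ≡ true → g i ≡ true) → count f ≤ count g
count-mono {zero} _ = z≤n
count-mono {suc n} f⇒g = +-mono-≤ (bit-mono (f⇒g zero)) (count-mono (f⇒g ∘ suc))

bit-∨ : ∀ a b → bit (a ∨ b) ≤ bit a + bit b
bit-∨ true b = s≤s z≤n
bit-∨ false b = ≤-refl

count-∨ : (f g : Fin n → Bool) → count (λ i → f i ∨ g i) ≤ count f + count g
count-∨ {zero} f g = z≤n
count-∨ {suc n} f g = begin
  bit (f zero ∨ g zero) + count (λ i → f (suc i) ∨ g (suc i))
    ≤⟨ +-mono-≤ (bit-∨ (f zero) (g zero)) (count-∨ (f ∘ suc) (g ∘ suc)) ⟩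
  (bit (f zero) + bit (g zero)) + (count (f ∘ suc) + count (g ∘ suc))
    ≡⟨ interchange (bit (f zero)) (bit (g zero)) _ _ ⟩
  count f + count g ∎

bit-∨-disjoint : (a ≡ true → b ≡ false) → bit (a ∨ b) ≡ bit a + bit b
bit-∨-disjoint {true} a⇒¬b rewrite a⇒¬b refl = refl
bit-∨-disjoint {false} _ = refl

count-∨-disjoint : {f g : Fin n → Bool} → (∀ i → f i ≡ true → g i ≡ false) →
  count (λ i → f i ∨ g i) ≡ count f + count g
count-∨-disjoint {zero} _ = refl
count-∨-disjoint {suc n} {f} {g} disjoint =
  trans (cong₂ _+_ (bit-∨-disjoint (disjoint zero)) (count-∨-disjoint (disjoint ∘ suc)))
        (interchange (bit (f zero)) (bit (g zero)) _ _)

bit-split : ∀ a b → bit a ≡ bit (a ∧ b) + bit (a ∧ not b)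
bit-split true true = refl
bit-split true false = refl
bit-split false b = refl

count-split : (f g : Fin n → Bool) →
  count f ≡ count (λ i → f i ∧ g i) + count (λ i → f i ∧ not (g i))
count-split {zero} f g = refl
count-split {suc n} f g =
  trans (cong₂ _+_ (bit-split (f zero) (g zero)) (count-split (f ∘ suc) (g ∘ suc)))
        (interchange (bit (f zero ∧ g zero)) (bit (f zero ∧ not (g zero))) _ _)

count-point : {f : Fin n → Bool} (x : Fin n) → f x ≡ true → 1 ≤ count f
count-point {f = f} x fx = begin
  1                   ≡⟨ cong bit (sym fx) ⟩
  bit (f x)           ≤⟨ sumF-point x ⟩
  sumF (bit ∘ f)      ≡⟨ sym (count≡sumF f) ⟩
  count f             ∎

count-witness : (f : Fin n → Bool) → 1 ≤ count f → ∃ λ i → f i ≡ true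
count-witness {suc n} f 1≤count with f zero in f0
... | true = zero , f0
... | false = let i , fi = count-witness (f ∘ suc) 1≤count in suc i , fi

count≤1 : {f : Fin n → Bool} (x : Fin n) → (∀ i → f i ≡ true → i ≡ x) → count f ≤ 1
count≤1 {f = f} x only-x = begin
  count f             ≡⟨ count≡sumF f ⟩
  sumF (bit ∘ f)      ≡⟨ sumF-single x (λ i i≢x → cong bit (≢true⇒≡false (i≢x ∘ only-x i))) ⟩
  bit (f x)           ≤⟨ bit-mono {b = true} (λ _ → refl) ⟩
  1                   ∎

count-two : (f : Fin n → Bool) → 2 ≤ count f → ∃₂ λ p q → p ≢ q × f p ≡ true × f q ≡ true
count-two f 2≤count =
  let p , fp = count-witness f (≤-trans (s≤s z≤n) 2≤count)
      others = λ i → f i ∧ not (isYes (i ≟ p))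
      1≤others = +-cancelˡ-≤ 1 1 (count others) (begin
        2 ≤⟨ 2≤count ⟩
        count f ≡⟨ count-split f (λ i → isYes (i ≟ p)) ⟩
        count (λ i → f i ∧ isYes (i ≟ p)) + count others
          ≤⟨ +-monoˡ-≤ _ (count≤1 p (λ i h → isYes⇒ (i ≟ p) (proj₂ (∧≡true h)))) ⟩
        1 + count others ∎)
      q , q-other = count-witness others 1≤others
      fq , q≢p = ∧≡true q-other
  in p , q , (λ p≡q → ≡true⇒≢false (isYes-yes (q ≟ p) (sym p≡q)) (not≡true⇒≡false q≢p)) , fp , fq

-- Arc sets

_⊆ᴬ_ : ArcSet n → ArcSet n → Set
M ⊆ᴬ N = ∀ u v → M u v ≡ true → N u v ≡ true

_∪ᴬ_ : ArcSet n → ArcSet n → ArcSet n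
(M ∪ᴬ N) u v = M u v ∨ N u v

｛_｝ : Fin n → VSet n
｛ x ｝ u = isYes (u ≟ x)

∁ : VSet n → VSet n
∁ S u = not (S u)

restrictTail : VSet n → ArcSet n → ArcSet n
restrictTail S M u v = M u v ∧ S u

restrictHead : VSet n → ArcSet n → ArcSet n
restrictHead S M u v = M u v ∧ S v

arc : Fin n → Fin n → ArcSet n
arc u v a b = ｛ u ｝ a ∧ ｛ v ｝ b

restrictTail⊆ : (S : VSet n) (M : ArcSet n) → restrictTail S M ⊆ᴬ M
restrictTail⊆ S M u v = proj₁ ∘ ∧≡true

restrictHead⊆ : (S : VSet n) (M : ArcSet n) → restrictHead S M ⊆ᴬ M
restrictHead⊆ S M u v = proj₁ ∘ ∧≡true

restrictTail-∁ : restrictTail (∁ S) M u v ≡ true → S u ≡ false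
restrictTail-∁ = not≡true⇒≡false ∘ proj₂ ∘ ∧≡true

arc-ends : arc u v w x ≡ true → w ≡ u × x ≡ v
arc-ends {u = u} {v} {w} {x} h =
  let w∈ , x∈ = ∧≡true h in isYes⇒ (w ≟ u) w∈ , isYes⇒ (x ≟ v) x∈

arc-self : (u v : Fin n) → arc u v u v ≡ true
arc-self u v rewrite isYes-yes (u ≟ u) refl = isYes-yes (v ≟ v) refl

outDeg-mono : M ⊆ᴬ N → ∀ u → outDeg M u ≤ outDeg N u
outDeg-mono M⊆N u = count-mono (M⊆N u)

inDeg-mono : M ⊆ᴬ N → ∀ v → inDeg M v ≤ inDeg N v
inDeg-mono M⊆N v = count-mono (λ u → M⊆N u v)

outDeg-∪ : (M N : ArcSet n) (u : Fin n) → outDeg (M ∪ᴬ N) u ≤ outDeg M u + outDeg N u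
outDeg-∪ M N u = count-∨ (M u) (N u)

inDeg-∪ : (M N : ArcSet n) (v : Fin n) → inDeg (M ∪ᴬ N) v ≤ inDeg M v + inDeg N v
inDeg-∪ M N v = count-∨ (λ u → M u v) (λ u → N u v)

outDeg-restrictTail-∉ : S u ≡ false → outDeg (restrictTail S M) u ≡ 0
outDeg-restrictTail-∉ {u = u} {M = M} u∉S =
  count-zero (λ v → trans (cong (M u v ∧_) u∉S) (∧-zeroʳ (M u v)))

inDeg-restrictHead-∉ : S v ≡ false → inDeg (restrictHead S M) v ≡ 0
inDeg-restrictHead-∉ {v = v} {M = M} v∉S =
  count-zero (λ u → trans (cong (M u v ∧_) v∉S) (∧-zeroʳ (M u v)))

inDeg-restrictHead-∈ : S v ≡ true → inDeg (restrictHead S M) v ≡ inDeg M v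
inDeg-restrictHead-∈ {v = v} {M = M} v∈S =
  count-cong (λ u → trans (cong (M u v ∧_) v∈S) (∧-identityʳ (M u v)))

outDeg-arc≤1 : ∀ p → outDeg (arc u v) p ≤ 1
outDeg-arc≤1 {v = v} p = count≤1 v (λ _ → proj₂ ∘ arc-ends)

inDeg-arc≤1 : ∀ d → inDeg (arc u v) d ≤ 1
inDeg-arc≤1 {u = u} d = count≤1 u (λ _ → proj₁ ∘ arc-ends)

outDeg-arc-≢ : w ≢ u → outDeg (arc u v) w ≡ 0
outDeg-arc-≢ {w = w} {u} {v} w≢u =
  count-zero (λ b → ≢true⇒≡false (λ h → w≢u (proj₁ (arc-ends {u = u} {v} {w} {b} h))))

inDeg-arc-≢ : x ≢ v → inDeg (arc u v) x ≡ 0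
inDeg-arc-≢ {x = x} {v} {u} x≢v =
  count-zero (λ a → ≢true⇒≡false (λ h → x≢v (proj₂ (arc-ends {u = u} {v} {a} {x} h))))

size-cong : (∀ u v → M u v ≡ N u v) → size M ≡ size N
size-cong M≗N = sumF-cong (λ u → count-cong (M≗N u))

size≡sumF-inDeg : (M : ArcSet n) → size M ≡ sumF (inDeg M)
size≡sumF-inDeg M = begin-equality
  sumF (λ u → count (M u))                    ≡⟨ sumF-cong (λ u → count≡sumF (M u)) ⟩
  sumF (λ u → sumF (λ v → bit (M u v)))       ≡⟨ sumF-swap (λ u v → bit (M u v)) ⟩
  sumF (λ v → sumF (λ u → bit (M u v)))       ≡⟨ sumF-cong (λ v → sym (count≡sumF (λ u → M u v))) ⟩
  sumF (inDeg M)                              ∎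

size-∪-disjoint : (∀ u v → M u v ≡ true → N u v ≡ false) → size (M ∪ᴬ N) ≡ size M + size N
size-∪-disjoint {M = M} {N} disjoint =
  trans (sumF-cong (λ u → count-∨-disjoint (disjoint u))) (sumF-+ (outDeg M) (outDeg N))

size-partition : (S : VSet n) (M : ArcSet n) →
  size M ≡ size (restrictTail S M) + size (restrictTail (∁ S) M)
size-partition S M =
  trans (sumF-cong (λ u → count-split (M u) (λ _ → S u)))
        (sumF-+ (outDeg (restrictTail S M)) (outDeg (restrictTail (∁ S) M)))

size-singleTail : (x : Fin n) → (∀ u v → M u v ≡ true → u ≡ x) → size M ≡ outDeg M x
size-singleTail x tail≡x = sumF-single x (λ u u≢x → count-zero (λ v → ≢true⇒≡false (u≢x ∘ tail≡x u v)))

size-singleHead : (x : Fin n) → (∀ u v → M u v ≡ true → v ≡ x) → size M ≡ inDeg M x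
size-singleHead {M = M} x head≡x =
  trans (size≡sumF-inDeg M)
        (sumF-single x (λ v v≢x → count-zero (λ u → ≢true⇒≡false (v≢x ∘ head≡x u v))))

arc⇒1≤size : M u v ≡ true → 1 ≤ size M
arc⇒1≤size {u = u} {v} Muv = ≤-trans (count-point v Muv) (sumF-point u)

head∈DM : M u v ≡ true → DM M v ≡ true
head∈DM {u = u} Muv = 1≤⇒isPos (count-point u Muv)

-- Fixed matchings

ValidArc : Digraph n → VSet n → Fin n → Fin n → Set
ValidArc A D u v = (A u v ≡ true) × (D u ≡ false) × (D v ≡ true)

module FixedMatchingProperties {n} {A : Digraph n} {c : Fin n → ℕ} {D : VSet n} {M : ArcSet n}
         (F : FixedMatching A c D M) where
  open FixedMatching F public

  tail∉D : M u v ≡ true → D u ≡ false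
  tail∉D Muv = proj₁ (proj₂ (arcs _ _ Muv))

  head∈D : M u v ≡ true → D v ≡ true
  head∈D Muv = proj₂ (proj₂ (arcs _ _ Muv))

  inDeg-∉D : D u ≡ false → inDeg M u ≡ 0
  inDeg-∉D {u = u} u∉D =
    count-zero {f = λ w → M w u} (λ w → ≢true⇒≡false (λ Mwu → ≡true⇒≢false (head∈D Mwu) u∉D))

  outDeg-∈D : D u ≡ true → outDeg M u ≡ 0
  outDeg-∈D {u = u} u∈D =
    count-zero {f = M u} (λ w → ≢true⇒≡false (λ Muw → ≡true⇒≢false u∈D (tail∉D Muw)))

  outDeg≤1 : ∀ p → outDeg M p ≤ 1
  outDeg≤1 p with D p in p∈D
  ... | false = capP p p∈D
  ... | true = ≤-trans (≤-reflexive (outDeg-∈D p∈D)) z≤n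

  DM⊆D : DM M d ≡ true → D d ≡ true
  DM⊆D {d = d} d∈DM = head∈D (proj₂ (count-witness (λ u → M u d) (isPos⇒1≤ d∈DM)))

  inDeg≤c : ∀ d → inDeg M d ≤ c d
  inDeg≤c d with DM M d in d∈DM
  ... | true = capD d (DM⊆D d∈DM)
  ... | false = ≤-trans (≤-reflexive (isPos≡false⇒≡0 d∈DM)) z≤n

  tail∉DM : M u v ≡ true → DM M u ≡ false
  tail∉DM Muv = cong isPos (inDeg-∉D (tail∉D Muv))

  validArc-addV : M u v ≡ true → u ≢ w → ValidArc A (addV (DM M) w) u v
  validArc-addV Muv u≢w =
    proj₁ (arcs _ _ Muv) , addV-∉ {D = DM M} (tail∉DM Muv) u≢w , addV-⊇ {D = DM M} (head∈DM {M = M} Muv)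

-- Local optimality

LocallyOptimalAt : Digraph n → (Fin n → ℕ) → ArcSet n → Fin n → Set
LocallyOptimalAt A c M v =
  DM M v ≡ false → ∀ M′ → FixedMatching A c (addV (DM M) v) M′ → size M′ ≤ size M

LocallyOptimal : Digraph n → (Fin n → ℕ) → ArcSet n → Set
LocallyOptimal A c M = ∀ v → LocallyOptimalAt A c M v

covered : ArcSet n → VSet n
covered M u = isPos (inDeg M u + outDeg M u)

tail-covered : (M : ArcSet n) → M u v ≡ true → covered M u ≡ true
tail-covered {u = u} {v = v} M Muv = 1≤⇒isPos (≤-trans (count-point v Muv) (m≤n+m _ (inDeg M u)))

uncovered-inDeg : (M : ArcSet n) → covered M u ≡ false → inDeg M u ≡ 0
uncovered-inDeg {u = u} M u∉cov = m+n≡0⇒m≡0 (inDeg M u) (isPos≡false⇒≡0 u∉cov)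

uncovered-outDeg : (M : ArcSet n) → covered M u ≡ false → outDeg M u ≡ 0
uncovered-outDeg {u = u} M u∉cov = m+n≡0⇒n≡0 (inDeg M u) (isPos≡false⇒≡0 u∉cov)

uncovered∉DM : (M : ArcSet n) → covered M u ≡ false → DM M u ≡ false
uncovered∉DM M u∉cov = cong isPos (uncovered-inDeg M u∉cov)

uncovered≢tail : (M : ArcSet n) → covered M w ≡ false → M u v ≡ true → u ≢ w
uncovered≢tail M w∉cov Muv refl = ≡true⇒≢false (tail-covered M Muv) w∉cov

module Approximation {n} {A : Digraph n} {c : Fin n → ℕ} {D : VSet n} {M : ArcSet n}
         (F : FixedMatching A c D M) (optimal : LocallyOptimal A c M)
         {D* : VSet n} {M* : ArcSet n} (F* : FixedMatching A c D* M*) where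
  open FixedMatchingProperties F
  module * = FixedMatchingProperties F*

  fromCovered fromUncovered : ArcSet n
  fromCovered = restrictTail (covered M) M*
  fromUncovered = restrictTail (∁ (covered M)) M*

  fromCovered⊆M* : fromCovered ⊆ᴬ M*
  fromCovered⊆M* = restrictTail⊆ (covered M) M*

  fromUncovered⊆M* : fromUncovered ⊆ᴬ M*
  fromUncovered⊆M* = restrictTail⊆ (∁ (covered M)) M*

  fromUncovered-tail : fromUncovered u v ≡ true → covered M u ≡ false
  fromUncovered-tail = restrictTail-∁ {S = covered M} {M = M*}

  validArc-fromUncovered : fromUncovered u v ≡ true → u ≢ w → addV (DM M) w v ≡ true →
    ValidArc A (addV (DM M) w) u v
  validArc-fromUncovered {u} {v} uv u≢w v∈ =
    proj₁ (*.arcs u v (fromUncovered⊆M* u v uv)) ,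
    addV-∉ {D = DM M} (uncovered∉DM M (fromUncovered-tail uv)) u≢w , v∈

  withoutOut uncoveredInto promote : Fin n → ArcSet n
  withoutOut x = restrictTail (∁ ｛ x ｝) M
  uncoveredInto x = restrictHead ｛ x ｝ fromUncovered
  promote x = withoutOut x ∪ᴬ uncoveredInto x

  withoutOut⊆M : ∀ x → withoutOut x ⊆ᴬ M
  withoutOut⊆M x = restrictTail⊆ (∁ ｛ x ｝) M

  uncoveredInto⊆fromUncovered : ∀ x → uncoveredInto x ⊆ᴬ fromUncovered
  uncoveredInto⊆fromUncovered x = restrictHead⊆ ｛ x ｝ fromUncovered

  uncoveredInto-head : uncoveredInto x u v ≡ true → v ≡ x
  uncoveredInto-head {x} {v = v} = isYes⇒ (v ≟ x) ∘ proj₂ ∘ ∧≡true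

  promote-size : ∀ x → size M + inDeg fromUncovered x ≤ outDeg M x + size (promote x)
  promote-size x = begin
    size M + inDeg fromUncovered x
      ≡⟨ cong (_+ inDeg fromUncovered x) (size-partition ｛ x ｝ M) ⟩
    (size leaving + size (withoutOut x)) + inDeg fromUncovered x
      ≡⟨ +-assoc (size leaving) (size (withoutOut x)) _ ⟩
    size leaving + (size (withoutOut x) + inDeg fromUncovered x)
      ≤⟨ +-mono-≤ leaving≤outDeg (≤-reflexive (cong (size (withoutOut x) +_) arriving)) ⟩
    outDeg M x + (size (withoutOut x) + size (uncoveredInto x))
      ≡⟨ cong (outDeg M x +_) (sym (size-∪-disjoint disjoint)) ⟩
    outDeg M x + size (promote x) ∎
    where
    leaving : ArcSet n
    leaving = restrictTail ｛ x ｝ M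

    leaving≤outDeg : size leaving ≤ outDeg M x
    leaving≤outDeg = begin
      size leaving   ≡⟨ size-singleTail x (λ u v h → isYes⇒ (u ≟ x) (proj₂ (∧≡true h))) ⟩
      outDeg leaving x ≤⟨ outDeg-mono (restrictTail⊆ ｛ x ｝ M) x ⟩
      outDeg M x     ∎

    arriving : inDeg fromUncovered x ≡ size (uncoveredInto x)
    arriving = sym (trans (size-singleHead x (λ u v → uncoveredInto-head))
                          (inDeg-restrictHead-∈ {S = ｛ x ｝} {M = fromUncovered} (isYes-yes (x ≟ x) refl)))

    disjoint : ∀ u v → withoutOut x u v ≡ true → uncoveredInto x u v ≡ false
    disjoint u v kept = ≢true⇒≡false λ joining →
      ≡true⇒≢false (tail-covered M (withoutOut⊆M x u v kept))
                   (fromUncovered-tail (uncoveredInto⊆fromUncovered x u v joining))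

  promote-fixed : DM M x ≡ false → D* x ≡ true → FixedMatching A c (addV (DM M) x) (promote x)
  FixedMatching.arcs (promote-fixed {x} _ x∈D*) u v h with ∨≡true h
  ... | inj₁ kept =
    let Muv , u≢x = ∧≡true kept
    in validArc-addV Muv λ u≡x → ≡true⇒≢false (isYes-yes (u ≟ x) u≡x) (not≡true⇒≡false u≢x)
  ... | inj₂ joining with uncoveredInto-head joining
  ... | refl = validArc-fromUncovered uv u≢x (addV-self (DM M) x)
    where
    uv : fromUncovered u x ≡ true
    uv = uncoveredInto⊆fromUncovered x u x joining
    u≢x : u ≢ x
    u≢x refl = ≡true⇒≢false x∈D* (*.tail∉D (fromUncovered⊆M* u x uv))
  FixedMatching.capD (promote-fixed {x} x∉DM _) d _ = capacity (d ≟ x)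
    where
    capacity : Dec (d ≡ x) → inDeg (promote x) d ≤ c d
    capacity (yes refl) = ≤-trans (inDeg-∪ (withoutOut x) (uncoveredInto x) x) (+-mono-≤ kept joining)
      where
      kept : inDeg (withoutOut x) x ≤ 0
      kept = ≤-trans (inDeg-mono (withoutOut⊆M x) x) (≤-reflexive (isPos≡false⇒≡0 x∉DM))
      joining : inDeg (uncoveredInto x) x ≤ c x
      joining = ≤-trans (inDeg-mono (uncoveredInto⊆fromUncovered x) x)
                        (≤-trans (inDeg-mono fromUncovered⊆M* x) (*.inDeg≤c x))
    capacity (no d≢x) = begin
      inDeg (promote x) d
        ≤⟨ inDeg-∪ (withoutOut x) (uncoveredInto x) d ⟩
      inDeg (withoutOut x) d + inDeg (uncoveredInto x) d
        ≡⟨ cong (inDeg (withoutOut x) d +_)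
                (inDeg-restrictHead-∉ {S = ｛ x ｝} {M = fromUncovered} (isYes-no (d ≟ x) d≢x)) ⟩
      inDeg (withoutOut x) d + 0
        ≡⟨ +-identityʳ _ ⟩
      inDeg (withoutOut x) d ≤⟨ inDeg-mono (withoutOut⊆M x) d ⟩
      inDeg M d              ≤⟨ inDeg≤c d ⟩
      c d                    ∎
  FixedMatching.capP (promote-fixed {x} _ _) p _ = passenger (covered M p) refl
    where
    passenger : ∀ b → covered M p ≡ b → outDeg (promote x) p ≤ 1
    passenger true p∈cov = ≤-trans (outDeg-∪ (withoutOut x) (uncoveredInto x) p) (+-mono-≤
      (≤-trans (outDeg-mono (withoutOut⊆M x) p) (outDeg≤1 p))
      (≤-trans (outDeg-mono (uncoveredInto⊆fromUncovered x) p)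
               (≤-reflexive (outDeg-restrictTail-∉ {S = ∁ (covered M)} {M = M*} (cong not p∈cov)))))
    passenger false p∉cov = ≤-trans (outDeg-∪ (withoutOut x) (uncoveredInto x) p) (+-mono-≤
      (≤-trans (outDeg-mono (withoutOut⊆M x) p) (≤-reflexive (uncovered-outDeg M p∉cov)))
      (count≤1 x (λ v → uncoveredInto-head)))

  fromUncovered-inDeg≤outDeg : ∀ x → DM M x ≡ false → D* x ≡ true →
    inDeg fromUncovered x ≤ outDeg M x
  fromUncovered-inDeg≤outDeg x x∉DM x∈D* = +-cancelˡ-≤ (size M) _ _ (begin
    size M + inDeg fromUncovered x  ≤⟨ promote-size x ⟩
    outDeg M x + size (promote x)
      ≤⟨ +-monoʳ-≤ (outDeg M x) (optimal x x∉DM _ (promote-fixed x∉DM x∈D*)) ⟩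
    outDeg M x + size M             ≡⟨ +-comm (outDeg M x) (size M) ⟩
    size M + outDeg M x             ∎)

  extend-size : covered M p ≡ false → size M < size (M ∪ᴬ arc p x)
  extend-size {p} {x} p∉cov =
    ≤-trans (m<m+n (size M) (arc⇒1≤size {M = arc p x} {p} {x} (arc-self p x)))
            (≤-reflexive (sym (size-∪-disjoint disjoint)))
    where
    disjoint : ∀ u v → M u v ≡ true → arc p x u v ≡ false
    disjoint u v Muv = ≢true⇒≡false λ arc-uv →
      uncovered≢tail M p∉cov Muv (proj₁ (arc-ends {u = p} {x} {u} {v} arc-uv))

  extend-fixed : DM M x ≡ true → fromUncovered p x ≡ true → covered M q ≡ false → p ≢ q →
    inDeg M x < inDeg fromUncovered x → FixedMatching A c (addV (DM M) q) (M ∪ᴬ arc p x)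
  FixedMatching.arcs (extend-fixed {x} {p} {q} x∈DM px q∉cov p≢q _) u v h with ∨≡true h
  ... | inj₁ Muv = validArc-addV Muv (uncovered≢tail M q∉cov Muv)
  ... | inj₂ arc-uv with arc-ends {u = p} {x} {u} {v} arc-uv
  ... | refl , refl = validArc-fromUncovered px p≢q (addV-⊇ {D = DM M} x∈DM)
  FixedMatching.capD (extend-fixed {x} {p} _ _ _ _ inDeg<U) d _ = capacity (d ≟ x)
    where
    capacity : Dec (d ≡ x) → inDeg (M ∪ᴬ arc p x) d ≤ c d
    capacity (yes refl) = begin
      inDeg (M ∪ᴬ arc p x) x          ≤⟨ inDeg-∪ M (arc p x) x ⟩
      inDeg M x + inDeg (arc p x) x   ≤⟨ +-monoʳ-≤ (inDeg M x) (inDeg-arc≤1 x) ⟩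
      inDeg M x + 1                   ≡⟨ +-comm (inDeg M x) 1 ⟩
      suc (inDeg M x)                 ≤⟨ inDeg<U ⟩
      inDeg fromUncovered x           ≤⟨ inDeg-mono fromUncovered⊆M* x ⟩
      inDeg M* x                      ≤⟨ *.inDeg≤c x ⟩
      c x                             ∎
    capacity (no d≢x) = begin
      inDeg (M ∪ᴬ arc p x) d          ≤⟨ inDeg-∪ M (arc p x) d ⟩
      inDeg M d + inDeg (arc p x) d   ≡⟨ cong (inDeg M d +_) (inDeg-arc-≢ d≢x) ⟩
      inDeg M d + 0                   ≡⟨ +-identityʳ (inDeg M d) ⟩
      inDeg M d                       ≤⟨ inDeg≤c d ⟩
      c d                             ∎
  FixedMatching.capP (extend-fixed {x} {p} _ px _ _ _) u _ = passenger (u ≟ p)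
    where
    passenger : Dec (u ≡ p) → outDeg (M ∪ᴬ arc p x) u ≤ 1
    passenger (yes refl) = ≤-trans (outDeg-∪ M (arc p x) p)
      (+-mono-≤ (≤-reflexive (uncovered-outDeg M (fromUncovered-tail px))) (outDeg-arc≤1 p))
    passenger (no u≢p) = ≤-trans (outDeg-∪ M (arc p x) u)
      (+-mono-≤ (outDeg≤1 u) (≤-reflexive (outDeg-arc-≢ u≢p)))

  fromUncovered-inDeg≤inDeg : ∀ x → DM M x ≡ true → inDeg fromUncovered x ≤ inDeg M x
  fromUncovered-inDeg≤inDeg x x∈DM = ≮⇒≥ λ inDeg<U →
    let 2≤U = ≤-trans (s≤s (isPos⇒1≤ x∈DM)) inDeg<U
        p , q , p≢q , px , qx = count-two (λ u → fromUncovered u x) 2≤U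
        q∉cov = fromUncovered-tail qx
    in <⇒≱ (extend-size (fromUncovered-tail px))
           (optimal q (uncovered∉DM M q∉cov) _ (extend-fixed x∈DM px q∉cov p≢q inDeg<U))

  fromUncovered-inDeg≤degree : ∀ x → D* x ≡ true → inDeg fromUncovered x ≤ inDeg M x + outDeg M x
  fromUncovered-inDeg≤degree x x∈D* with DM M x in DM-x
  ... | true = ≤-trans (fromUncovered-inDeg≤inDeg x DM-x) (m≤m+n _ _)
  ... | false = ≤-trans (fromUncovered-inDeg≤outDeg x DM-x x∈D*) (m≤n+m _ _)

  fromCovered-outDeg≤degree : ∀ x → outDeg fromCovered x ≤ inDeg M x + outDeg M x
  fromCovered-outDeg≤degree x = byCoverage (covered M x) refl
    where
    byCoverage : ∀ b → covered M x ≡ b → outDeg fromCovered x ≤ inDeg M x + outDeg M x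
    byCoverage true x∈cov = ≤-trans (outDeg-mono fromCovered⊆M* x)
                                    (≤-trans (*.outDeg≤1 x) (isPos⇒1≤ x∈cov))
    byCoverage false x∉cov =
      ≤-trans (≤-reflexive (outDeg-restrictTail-∉ {S = covered M} {M = M*} x∉cov)) z≤n

  charge≤degree : ∀ x → outDeg fromCovered x + inDeg fromUncovered x ≤ inDeg M x + outDeg M x
  charge≤degree x with D* x in D*-x
  ... | true = begin
    outDeg fromCovered x + inDeg fromUncovered x   ≤⟨ +-monoˡ-≤ _ (outDeg-mono fromCovered⊆M* x) ⟩
    outDeg M* x + inDeg fromUncovered x            ≡⟨ cong (_+ inDeg fromUncovered x) (*.outDeg-∈D D*-x) ⟩
    inDeg fromUncovered x                          ≤⟨ fromUncovered-inDeg≤degree x D*-x ⟩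
    inDeg M x + outDeg M x                         ∎
  ... | false = begin
    outDeg fromCovered x + inDeg fromUncovered x
      ≤⟨ +-mono-≤ (fromCovered-outDeg≤degree x) (inDeg-mono fromUncovered⊆M* x) ⟩
    (inDeg M x + outDeg M x) + inDeg M* x          ≡⟨ cong (inDeg M x + outDeg M x +_) (*.inDeg-∉D D*-x) ⟩
    (inDeg M x + outDeg M x) + 0                   ≡⟨ +-identityʳ _ ⟩
    inDeg M x + outDeg M x                         ∎

  size≤2*size : size M* ≤ 2 * size M
  size≤2*size = begin
    size M*                                   ≡⟨ size-partition (covered M) M* ⟩
    size fromCovered + size fromUncovered     ≡⟨ cong (size fromCovered +_) (size≡sumF-inDeg fromUncovered) ⟩
    sumF (outDeg fromCovered) + sumF (inDeg fromUncovered)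
                                              ≡⟨ sym (sumF-+ (outDeg fromCovered) (inDeg fromUncovered)) ⟩
    sumF (λ x → outDeg fromCovered x + inDeg fromUncovered x)
                                              ≤⟨ sumF-mono charge≤degree ⟩
    sumF (λ x → inDeg M x + outDeg M x)       ≡⟨ sumF-+ (inDeg M) (outDeg M) ⟩
    sumF (inDeg M) + size M                   ≡⟨ cong (_+ size M) (sym (size≡sumF-inDeg M)) ⟩
    size M + size M                           ≡⟨ cong (size M +_) (sym (+-identityʳ (size M))) ⟩
    2 * size M                                ∎

-- The local search

Step-size≤ : Step A c v M M′ → size M ≤ size M′
Step-size≤ (skip _) = ≤-refl
Step-size≤ (improve _ _ M<M′) = <⇒≤ M<M′
Step-size≤ (keep _ _ _) = ≤-refl

Steps-size≤ : ∀ {vs} → Steps A c vs M M′ → size M ≤ size M′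
Steps-size≤ done = ≤-refl
Steps-size≤ (next step steps) = ≤-trans (Step-size≤ step) (Steps-size≤ steps)

Step-feasible : Step A c v M M′ → Feasible A c M → Feasible A c M′
Step-feasible (skip _) feasible = feasible
Step-feasible {v = v} {M = M} (improve _ (fixed , _) _) _ = addV (DM M) v , fixed
Step-feasible (keep _ _ _) feasible = feasible

Steps-feasible : ∀ {vs} → Steps A c vs M M′ → Feasible A c M → Feasible A c M′
Steps-feasible done = id
Steps-feasible (next step steps) = Steps-feasible steps ∘ Step-feasible step

Steps-stable⇒locallyOptimal : ∀ {vs} → Steps A c vs M M′ → size M′ ≤ size M →
  All (LocallyOptimalAt A c M) vs
Steps-stable⇒locallyOptimal done _ = []
Steps-stable⇒locallyOptimal (next (skip v∈DM) steps) stable =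
  (λ v∉DM → ⊥-elim (≡true⇒≢false v∈DM v∉DM)) ∷ Steps-stable⇒locallyOptimal steps stable
Steps-stable⇒locallyOptimal (next (improve _ _ M<M′) steps) stable =
  ⊥-elim (<⇒≱ M<M′ (≤-trans (Steps-size≤ steps) stable))
Steps-stable⇒locallyOptimal (next (keep _ (_ , maximum) M′≤M) steps) stable =
  (λ _ M″ fixed → ≤-trans (maximum M″ fixed) M′≤M) ∷ Steps-stable⇒locallyOptimal steps stable

Run⇒feasible×locallyOptimal : ∀ {Mout} → Run A c M Mout → Feasible A c M →
  Feasible A c Mout × LocallyOptimal A c Mout
Run⇒feasible×locallyOptimal (stop pass same) feasible = feasible , λ v →
  All-lookup (Steps-stable⇒locallyOptimal pass (≤-reflexive (sym (size-cong same)))) (∈-allFin v)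
Run⇒feasible×locallyOptimal (again pass _ run) feasible =
  Run⇒feasible×locallyOptimal run (Steps-feasible pass feasible)

emptyArcs-feasible : (A : Digraph n) (c : Fin n → ℕ) → Feasible A c emptyArcs
emptyArcs-feasible A c = (λ _ → false) , record
  { arcs = λ _ _ ()
  ; capD = λ _ ()
  ; capP = λ p _ → ≤-trans (≤-reflexive (count-zero {f = emptyArcs p} (λ _ → refl))) z≤n
  }

mainTheorem1 : ∀ {n} (A : Digraph n) (c : Fin n → ℕ) (M : ArcSet n) →
    Run A c emptyArcs M →
    Feasible A c M × (∀ (Dstar : VSet n) (Mstar : ArcSet n) → FixedMatching A c Dstar Mstar → size Mstar ≤ 2 * size M)
mainTheorem1 A c M run with Run⇒feasible×locallyOptimal run (emptyArcs-feasible A c)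
... | (D , F) , optimal = (D , F) , λ _ _ F* → Approximation.size≤2*size F optimal F*
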